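{- Let $q$ be a prime power, $\theta$ a generator of $\mathbb{F}_{q^2}^*$, and $H=\{0,q+1,\dots,(q-2)(q+1)\}$ the subgroup of $\mathbb{Z}_{q^2-1}$ generated by $q+1$. Let $0\leq i\leq q$ and $H+i=\{h+i : h\in H\}$. If $x$ and $y$ are distinct vertices of $G_{q,\theta}$ in $H+i$, then $x$ and $y$ are not joined by a path of length two in $G_{q,\theta}$.
   Context: Let $A=\{a\in\mathbb{Z}_{q^2-1} : \theta^a-\theta\in\mathbb{F}_q\}$. $G_{q,\theta}$ is the simple graph (no loops) with vertex set $\mathbb{Z}_{q^2-1}$ in which two distinct vertices $x,y$ are adjacent if and only if $x+y\in A$. -}

module Defs where

open import Level using (Level; _⊔_) renaming (suc to lsuc)
open import Algebra.Bundles using (CommutativeRing; Semiring)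
import Algebra.Definitions.RawSemiring as RawSemiringDefs
open import Data.Nat using (ℕ; zero; suc; _∸_; _≤_) renaming (_^_ to _^ℕ_; _+_ to _+ℕ_; _*_ to _*ℕ_)
open import Data.Nat.DivMod using (_mod_; _%_)
open import Data.Nat.Primality using (Prime)
open import Data.Fin using (Fin; toℕ)
open import Data.Product using (Σ; ∃; _×_; _,_)
open import Relation.Nullary using (¬_)
open import Relation.Binary.PropositionalEquality using (_≡_; _≢_)

IsPrimePower : ℕ → Set
IsPrimePower q = Σ ℕ λ p → Σ ℕ λ k → Prime p × 1 ≤ k × q ≡ p ^ℕ k

_⊕_ : ∀ {N} → Fin N → Fin N → Fin N
_⊕_ {suc n} x y = (toℕ x +ℕ toℕ y) mod suc n

modN : ℕ → ℕ → ℕ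
modN zero a = a
modN (suc n) a = a % suc n

module FieldDefs {c ℓ} (R : CommutativeRing c ℓ) where
  open CommutativeRing R
  open RawSemiringDefs (Semiring.rawSemiring semiring) using (_^_)

  IsField : Set (c ⊔ ℓ)
  IsField = (¬ (0# ≈ 1#)) × (∀ x → ¬ (x ≈ 0#) → ∃ λ y → x * y ≈ 1#)

  HasCard : ℕ → Set (c ⊔ ℓ)
  HasCard n = Σ (Fin n → Carrier) λ e →
    (∀ i j → e i ≈ e j → i ≡ j) × (∀ x → ∃ λ i → e i ≈ x)

  IsSubfield : ∀ {s} → (Carrier → Set s) → Set (c ⊔ ℓ ⊔ s)
  IsSubfield S = (∀ {x y} → x ≈ y → S x → S y)
               × S 0# × S 1#
               × (∀ {x y} → S x → S y → S (x + y))
               × (∀ {x y} → S x → S y → S (x * y))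
               × (∀ {x} → S x → S (- x))
               × (∀ {x} → S x → ¬ (x ≈ 0#) → Σ Carrier λ y → S y × x * y ≈ 1#)

  SubsetCard : ∀ {s} → (Carrier → Set s) → ℕ → Set (c ⊔ ℓ ⊔ s)
  SubsetCard S n = Σ (Fin n → Carrier) λ e →
    (∀ i j → e i ≈ e j → i ≡ j) × (∀ i → S (e i)) × (∀ x → S x → ∃ λ i → e i ≈ x)

  IsGenerator : Carrier → Set (c ⊔ ℓ)
  IsGenerator θ = (¬ (θ ≈ 0#)) × (∀ x → ¬ (x ≈ 0#) → ∃ λ a → x ≈ θ ^ a)

  -- The graph G_{q,θ}, with F_q given as the subfield S
  module Graph {s} (S : Carrier → Set s) (θ : Carrier) (q : ℕ) where
    N : ℕ
    N = q *ℕ q ∸ 1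

    InA : Fin N → Set s
    InA a = S (θ ^ toℕ a - θ)

    -- adjacency in G_{q,θ} (simple graph: distinct vertices)
    Adj : Fin N → Fin N → Set s
    Adj x y = x ≢ y × InA (x ⊕ y)

    PathTwo : Fin N → Fin N → Set s
    PathTwo x y = ∃ λ z → Adj x z × Adj z y

    InCoset : Fin N → ℕ → Set
    InCoset x i = ∃ λ k → k ≤ q ∸ 2 × toℕ x ≡ modN N (k *ℕ (q +ℕ 1) +ℕ i)

-- Write n = q² − 1 = (q − 1)(q + 1).  Since θ generates the cyclic group F_{q²}^* of order n,
-- the powers of θ lying in the subfield F_q are exactly those with exponent divisible by the
-- least such exponent g, and counting the q elements of F_q gives q = 1 + n / g, i.e. g = q + 1.
-- So θ ∉ F_q, while λ = θ^(q+1) ∈ F_q and λ^k ≠ 1 for 0 < k ≤ q − 2.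
-- If x, y ∈ H + i had a common neighbour z, then θ^(x+z) = λ^k · θ^(y+z) for some such k
-- (up to swapping x and y), and both θ^(x+z) − θ and θ^(y+z) − θ lie in F_q.  Writing
-- c = λ^k and Q = θ^(y+z), the element (c − 1)θ = (cQ − θ) − c(Q − θ) would then lie in F_q,
-- and dividing by c − 1 ≠ 0 would put θ in F_q.
module Submission where

open import Defs
open import Algebra.Bundles using (CommutativeRing)
open import Data.Nat using (ℕ; _*_; _∸_; _≤_)
open import Data.Fin using (Fin)
open import Relation.Nullary using (¬_)
open import Relation.Binary.PropositionalEquality using (_≢_)

open import Data.Empty using (⊥-elim)
open import Data.Fin as Fin using (toℕ; fromℕ<; punchIn; punchOut)
import Data.Fin.Properties as Finₚ
open import Data.Nat as ℕ using (zero; suc; _<_; NonZero; >-nonZero; z≤n; s≤s)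
open import Data.Nat.DivMod using (_%_; _/_; _mod_; m≡m%n+[m/n]*n; m%n<n)
open import Data.Nat.Divisibility using (_∣_; m%n≡0⇒n∣m)
open import Data.Nat.Primality using (prime; prime⇒nonZero)
import Data.Nat.Properties as ℕₚ
open import Data.Nat.Tactic.RingSolver using (solve-∀)
open import Data.Product using (∃; ∃₂; _×_; _,_; proj₁; proj₂)
open import Function using (_∘_)
open import Relation.Binary.Definitions using (tri<; tri≈; tri>)
open import Relation.Binary.PropositionalEquality as ≡ using (_≡_; refl; cong; subst)
open import Relation.Nullary using (Dec; yes; no; ¬?)
open import Relation.Nullary.Decidable using (decidable-stable; map′)

2≤primePower : ∀ {q} → IsPrimePower q → 2 ≤ q
2≤primePower (p , k , p-prime@(prime {{p>1}} _) , 1≤k , refl) =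
  ℕₚ.≤-trans (ℕ.nonTrivial⇒n>1 p {{p>1}})
    (ℕₚ.≤-trans (ℕₚ.≤-reflexive (≡.sym (ℕₚ.^-identityʳ p)))
      (ℕₚ.^-monoʳ-≤ p {{prime⇒nonZero p-prime}} 1≤k))

q*q∸1≡[q∸1]*[q+1] : ∀ q → q * q ∸ 1 ≡ (q ∸ 1) * (q ℕ.+ 1)
q*q∸1≡[q∸1]*[q+1] zero    = refl
q*q∸1≡[q∸1]*[q+1] (suc r) = expand r
  where
  expand : ∀ r → r ℕ.+ r * suc r ≡ r * (suc r ℕ.+ 1)
  expand = solve-∀

least : ∀ {p} {P : ℕ → Set p} → (∀ k → Dec (P k)) →
        ∀ {n} → P n → ∃ λ g → P g × (∀ {j} → j < g → ¬ P j)
least {P = P} P? {n} Pn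
  with Finₚ.¬∀⟶∃¬-smallest (suc n) (¬_ ∘ P ∘ toℕ) (¬? ∘ P? ∘ toℕ)
         (λ ¬P → ¬P (Fin.fromℕ n) (subst P (≡.sym (Finₚ.toℕ-fromℕ n)) Pn))
... | g , ¬¬Pg , below =
  toℕ g , decidable-stable (P? (toℕ g)) ¬¬Pg ,
  λ j<g → subst (¬_ ∘ P) (≡.trans (Finₚ.toℕ-inject _) (Finₚ.toℕ-fromℕ< j<g)) (below (fromℕ< j<g))

record IsLeastPositive {p} (P : ℕ → Set p) (g : ℕ) : Set p where
  field
    positive : 0 < g
    holds    : P g
    minimal  : ∀ {j} → 0 < j → j < g → ¬ P j

least-positive : ∀ {p} {P : ℕ → Set p} → (∀ k → Dec (P k)) →
                 ∀ {n} → 0 < n → P n → ∃ (IsLeastPositive P)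
least-positive {P = P} P? {suc n} _ Pn with least (P? ∘ suc) Pn
... | g , Pg , below = suc g , record { positive = s≤s z≤n ; holds = Pg ; minimal = minimal }
  where
  minimal : ∀ {j} → 0 < j → j < suc g → ¬ P j
  minimal {suc j} _ (s≤s j<g) = below j<g

modN≡% : ∀ n .{{_ : NonZero n}} a → modN n a ≡ a % n
modN≡% (suc n) a = refl

toℕ-⊕ : ∀ {n} .{{_ : NonZero n}} (x y : Fin n) → toℕ (x ⊕ y) ≡ (toℕ x ℕ.+ toℕ y) % n
toℕ-⊕ {suc n} x y = Finₚ.toℕ-fromℕ< _

⊕-comm : ∀ {n} (x y : Fin n) → x ⊕ y ≡ y ⊕ x
⊕-comm {suc n} x y = cong (_mod suc n) (ℕₚ.+-comm (toℕ x) (toℕ y))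

module FieldProperties {c ℓ} (R : CommutativeRing c ℓ) (isField : FieldDefs.IsField R) where
  open CommutativeRing R
    renaming (_*_ to _·_; refl to ≈-refl; sym to ≈-sym; trans to ≈-trans)
  open FieldDefs R using (HasCard; IsGenerator; IsSubfield; SubsetCard)
  open import Algebra.Properties.Semiring.Exp semiring using (_^_; ^-homo-*; ^-assocʳ; ^-congˡ)
  open import Algebra.Properties.Ring ring
    using (⁻¹-anti-homo‿-; x∙y⁻¹≈ε⇒x≈y; x[y-z]≈xy-xz; [y-z]x≈yx-zx)
  open import Relation.Binary.Reasoning.Setoid setoid

  0≉1 : ¬ 0# ≈ 1#
  0≉1 = proj₁ isField

  ·-cancelˡ : ∀ {x y z} → ¬ x ≈ 0# → x · y ≈ x · z → y ≈ z
  ·-cancelˡ {x} {y} {z} x≉0 xy≈xz with proj₂ isField x x≉0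
  ... | x⁻¹ , xx⁻¹≈1 = begin
    y              ≈⟨ ≈-sym (*-identityˡ y) ⟩
    1# · y         ≈⟨ *-congʳ (≈-trans (≈-sym xx⁻¹≈1) (*-comm x x⁻¹)) ⟩
    (x⁻¹ · x) · y  ≈⟨ *-assoc x⁻¹ x y ⟩
    x⁻¹ · (x · y)  ≈⟨ *-congˡ xy≈xz ⟩
    x⁻¹ · (x · z)  ≈⟨ ≈-sym (*-assoc x⁻¹ x z) ⟩
    (x⁻¹ · x) · z  ≈⟨ *-congʳ (≈-trans (*-comm x⁻¹ x) xx⁻¹≈1) ⟩
    1# · z         ≈⟨ *-identityˡ z ⟩
    z              ∎

  ·-≉0 : ∀ {x y} → ¬ x ≈ 0# → ¬ y ≈ 0# → ¬ x · y ≈ 0#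
  ·-≉0 {x} x≉0 y≉0 xy≈0 = y≉0 (·-cancelˡ x≉0 (≈-trans xy≈0 (≈-sym (zeroʳ x))))

  ^-≉0 : ∀ {x} n → ¬ x ≈ 0# → ¬ x ^ n ≈ 0#
  ^-≉0 zero    _   1≈0 = 0≉1 (≈-sym 1≈0)
  ^-≉0 (suc n) x≉0     = ·-≉0 x≉0 (^-≉0 n x≉0)

  1^n≈1 : ∀ n → 1# ^ n ≈ 1#
  1^n≈1 zero    = ≈-refl
  1^n≈1 (suc n) = ≈-trans (*-identityˡ _) (1^n≈1 n)

  x^d≈1⇒x^a≈x^[a%d] : ∀ {x} d .{{_ : NonZero d}} → x ^ d ≈ 1# → ∀ a → x ^ a ≈ x ^ (a % d)
  x^d≈1⇒x^a≈x^[a%d] {x} d x^d≈1 a = begin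
    x ^ a                             ≡⟨ cong (x ^_) (m≡m%n+[m/n]*n a d) ⟩
    x ^ (a % d ℕ.+ (a / d) * d)       ≈⟨ ^-homo-* x (a % d) _ ⟩
    x ^ (a % d) · x ^ ((a / d) * d)   ≡⟨ cong (λ k → x ^ (a % d) · x ^ k) (ℕₚ.*-comm (a / d) d) ⟩
    x ^ (a % d) · x ^ (d * (a / d))   ≈⟨ *-congˡ (≈-sym (^-assocʳ x d (a / d))) ⟩
    x ^ (a % d) · (x ^ d) ^ (a / d)   ≈⟨ *-congˡ (≈-trans (^-congˡ (a / d) x^d≈1) (1^n≈1 (a / d))) ⟩
    x ^ (a % d) · 1#                  ≈⟨ *-identityʳ _ ⟩
    x ^ (a % d)                       ∎

  x^i≈x^j⇒x^[j∸i]≈1 : ∀ {x i j} → ¬ x ≈ 0# → i ≤ j → x ^ i ≈ x ^ j → x ^ (j ∸ i) ≈ 1#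
  x^i≈x^j⇒x^[j∸i]≈1 {x} {i} {j} x≉0 i≤j x^i≈x^j = ≈-sym (·-cancelˡ (^-≉0 i x≉0) (begin
    x ^ i · 1#                ≈⟨ *-identityʳ _ ⟩
    x ^ i                     ≈⟨ x^i≈x^j ⟩
    x ^ j                     ≡⟨ cong (x ^_) (≡.sym (ℕₚ.m+[n∸m]≡n i≤j)) ⟩
    x ^ (i ℕ.+ (j ∸ i))       ≈⟨ ^-homo-* x i (j ∸ i) ⟩
    x ^ i · x ^ (j ∸ i)       ∎))

  [ab-t]-a[b-t]≈[a-1]t : ∀ a b t → (a · b - t) - a · (b - t) ≈ (a - 1#) · t
  [ab-t]-a[b-t]≈[a-1]t a b t = begin
    (a · b - t) - a · (b - t)           ≈⟨ +-congˡ (-‿cong (x[y-z]≈xy-xz a b t)) ⟩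
    (a · b - t) - (a · b - a · t)       ≈⟨ +-congˡ (⁻¹-anti-homo‿- (a · b) (a · t)) ⟩
    (a · b - t) + (a · t - a · b)       ≈⟨ +-comm _ _ ⟩
    (a · t - a · b) + (a · b - t)       ≈⟨ +-assoc (a · t) (- (a · b)) _ ⟩
    a · t + (- (a · b) + (a · b - t))   ≈⟨ +-congˡ (≈-sym (+-assoc _ (a · b) (- t))) ⟩
    a · t + ((- (a · b) + a · b) - t)   ≈⟨ +-congˡ (+-congʳ (-‿inverseˡ (a · b))) ⟩
    a · t + (0# - t)                    ≈⟨ +-congˡ (+-identityˡ (- t)) ⟩
    a · t - t                           ≈⟨ +-congˡ (-‿cong (≈-sym (*-identityˡ t))) ⟩
    a · t - 1# · t                      ≈⟨ ≈-sym ([y-z]x≈yx-zx t a 1#) ⟩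
    (a - 1#) · t                        ∎

  module Subfield {s} {S : Carrier → Set s} (isSubfield : IsSubfield S) where

    S-resp : ∀ {x y} → x ≈ y → S x → S y
    S-resp = proj₁ isSubfield

    S-0 : S 0#
    S-0 = proj₁ (proj₂ isSubfield)

    S-1 : S 1#
    S-1 = proj₁ (proj₂ (proj₂ isSubfield))

    S-+ : ∀ {x y} → S x → S y → S (x + y)
    S-+ = proj₁ (proj₂ (proj₂ (proj₂ isSubfield)))

    S-· : ∀ {x y} → S x → S y → S (x · y)
    S-· = proj₁ (proj₂ (proj₂ (proj₂ (proj₂ isSubfield))))

    S-‿ : ∀ {x} → S x → S (- x)
    S-‿ = proj₁ (proj₂ (proj₂ (proj₂ (proj₂ (proj₂ isSubfield)))))

    S-⁻¹ : ∀ {x} → S x → ¬ x ≈ 0# → ∃ λ y → S y × x · y ≈ 1#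
    S-⁻¹ = proj₂ (proj₂ (proj₂ (proj₂ (proj₂ (proj₂ isSubfield)))))

    S-- : ∀ {x y} → S x → S y → S (x - y)
    S-- Sx Sy = S-+ Sx (S-‿ Sy)

    S-^ : ∀ {x} k → S x → S (x ^ k)
    S-^ zero    _  = S-1
    S-^ (suc k) Sx = S-· Sx (S-^ k Sx)

    S-·-cancelʳ : ∀ {x y} → S y → ¬ y ≈ 0# → S (x · y) → S x
    S-·-cancelʳ {x} {y} Sy y≉0 Sxy with S-⁻¹ Sy y≉0
    ... | y⁻¹ , Sy⁻¹ , yy⁻¹≈1 = S-resp xy·y⁻¹≈x (S-· Sxy Sy⁻¹)
      where
      xy·y⁻¹≈x : (x · y) · y⁻¹ ≈ x
      xy·y⁻¹≈x = ≈-trans (*-assoc x y y⁻¹) (≈-trans (*-congˡ yy⁻¹≈1) (*-identityʳ x))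

    ab-t∈S⇒b-t∉S : ∀ {a b t} → ¬ S t → S a → ¬ a ≈ 1# → S (a · b - t) → ¬ S (b - t)
    ab-t∈S⇒b-t∉S {a} {b} {t} t∉S Sa a≉1 Sab-t Sb-t = t∉S (S-·-cancelʳ Sa-1 a-1≉0 St[a-1])
      where
      Sa-1 : S (a - 1#)
      Sa-1 = S-- Sa S-1
      a-1≉0 : ¬ a - 1# ≈ 0#
      a-1≉0 = a≉1 ∘ x∙y⁻¹≈ε⇒x≈y a 1#
      St[a-1] : S (t · (a - 1#))
      St[a-1] = S-resp (≈-trans ([ab-t]-a[b-t]≈[a-1]t a b t) (*-comm (a - 1#) t))
                  (S-- Sab-t (S-· Sa Sb-t))

  module Finite {n} (card : HasCard (suc n)) where

    private
      enum : Fin (suc n) → Carrier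
      enum = proj₁ card

      enum-injective : ∀ i j → enum i ≈ enum j → i ≡ j
      enum-injective = proj₁ (proj₂ card)

      index : Carrier → Fin (suc n)
      index x = proj₁ (proj₂ (proj₂ card) x)

      enum-index : ∀ x → enum (index x) ≈ x
      enum-index x = proj₂ (proj₂ (proj₂ card) x)

    index-injective : ∀ {x y} → index x ≡ index y → x ≈ y
    index-injective {x} {y} eq =
      ≈-trans (≈-sym (enum-index x)) (≈-trans (reflexive (cong enum eq)) (enum-index y))

    _≈?_ : ∀ x y → Dec (x ≈ y)
    x ≈? y = map′ index-injective
      (λ x≈y → enum-injective _ _ (≈-trans (enum-index x) (≈-trans x≈y (≈-sym (enum-index y)))))
      (index x Finₚ.≟ index y)

    nonzero : Fin n → Carrier
    nonzero j = enum (punchIn (index 0#) j)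

    nonzero-≉0 : ∀ j → ¬ nonzero j ≈ 0#
    nonzero-≉0 j j≈0 =
      Finₚ.punchInᵢ≢i (index 0#) j (enum-injective _ _ (≈-trans j≈0 (≈-sym (enum-index 0#))))

    nonzero-injective : ∀ {i j} → nonzero i ≈ nonzero j → i ≡ j
    nonzero-injective = Finₚ.punchIn-injective (index 0#) _ _ ∘ enum-injective _ _

    module Generator {θ} (generator : IsGenerator θ) where

      θ^≉0 : ∀ a → ¬ θ ^ a ≈ 0#
      θ^≉0 a = ^-≉0 a (proj₁ generator)

      log-below : ∀ d .{{_ : NonZero d}} → θ ^ d ≈ 1# → ∀ {x} → ¬ x ≈ 0# →
                  ∃ λ a → a < d × x ≈ θ ^ a
      log-below d θ^d≈1 x≉0 with proj₂ generator _ x≉0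
      ... | a , x≈θ^a = a % d , m%n<n a d , ≈-trans x≈θ^a (x^d≈1⇒x^a≈x^[a%d] d θ^d≈1 a)

      n≤order : ∀ d .{{_ : NonZero d}} → θ ^ d ≈ 1# → n ≤ d
      n≤order d θ^d≈1 = Finₚ.injective⇒≤ {f = exponent} exponent-injective
        where
        log : ∀ j → ∃ λ a → a < d × nonzero j ≈ θ ^ a
        log j = log-below d θ^d≈1 (nonzero-≉0 j)

        exponent : Fin n → Fin d
        exponent j = fromℕ< (proj₁ (proj₂ (log j)))

        exponent-injective : ∀ {i j} → exponent i ≡ exponent j → i ≡ j
        exponent-injective {i} {j} eq = nonzero-injective (begin
          nonzero i        ≈⟨ proj₂ (proj₂ (log i)) ⟩
          θ ^ proj₁ (log i) ≡⟨ cong (θ ^_) (Finₚ.fromℕ<-injective _ _ _ _ eq) ⟩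
          θ ^ proj₁ (log j) ≈⟨ ≈-sym (proj₂ (proj₂ (log j))) ⟩
          nonzero j        ∎)

      index0≢index[θ^] : ∀ a → index 0# ≢ index (θ ^ a)
      index0≢index[θ^] a eq = θ^≉0 a (≈-sym (index-injective eq))

      -- Pigeonhole: the n + 1 powers θ⁰, …, θⁿ are nonzero, but there are only n nonzero elements.
      powers-collide : ∃₂ λ i j → i < j × j ≤ n × θ ^ i ≈ θ ^ j
      powers-collide with Finₚ.pigeonhole (ℕₚ.n<1+n n) (λ j → punchOut (index0≢index[θ^] (toℕ j)))
      ... | i , j , i<j , eq = toℕ i , toℕ j , i<j , ℕₚ.≤-pred (Finₚ.toℕ<n j) ,
        index-injective (Finₚ.punchOut-injective (index0≢index[θ^] (toℕ i)) (index0≢index[θ^] (toℕ j)) eq)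

      instance
        n≢0 : NonZero n
        n≢0 with powers-collide
        ... | _ , _ , i<j , j≤n , _ = >-nonZero (ℕₚ.<-≤-trans (ℕₚ.≤-<-trans z≤n i<j) j≤n)

      θ^n≈1 : θ ^ n ≈ 1#
      θ^n≈1 with powers-collide
      ... | i , j , i<j , j≤n , θ^i≈θ^j = subst (λ d → θ ^ d ≈ 1#) d≡n θ^d≈1
        where
        θ^d≈1 : θ ^ (j ∸ i) ≈ 1#
        θ^d≈1 = x^i≈x^j⇒x^[j∸i]≈1 (proj₁ generator) (ℕₚ.<⇒≤ i<j) θ^i≈θ^j
        d≡n : j ∸ i ≡ n
        d≡n = ℕₚ.≤-antisym (ℕₚ.≤-trans (ℕₚ.m∸n≤m j i) j≤n)
                (n≤order (j ∸ i) {{>-nonZero (ℕₚ.m<n⇒0<n∸m i<j)}} θ^d≈1)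

      θ^j≉1 : ∀ {j} → 0 < j → j < n → ¬ θ ^ j ≈ 1#
      θ^j≉1 {j} 0<j j<n θ^j≈1 = ℕₚ.<⇒≱ j<n (n≤order j {{>-nonZero 0<j}} θ^j≈1)

      θ^-injective : ∀ {a b} → a < n → b < n → θ ^ a ≈ θ ^ b → a ≡ b
      θ^-injective {a} {b} a<n b<n θ^a≈θ^b with ℕₚ.<-cmp a b
      ... | tri≈ _ a≡b _ = a≡b
      ... | tri< a<b _ _ = ⊥-elim (θ^j≉1 (ℕₚ.m<n⇒0<n∸m a<b) (ℕₚ.≤-<-trans (ℕₚ.m∸n≤m b a) b<n)
                             (x^i≈x^j⇒x^[j∸i]≈1 (proj₁ generator) (ℕₚ.<⇒≤ a<b) θ^a≈θ^b))
      ... | tri> _ _ b<a = ⊥-elim (θ^j≉1 (ℕₚ.m<n⇒0<n∸m b<a) (ℕₚ.≤-<-trans (ℕₚ.m∸n≤m a b) a<n)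
                             (x^i≈x^j⇒x^[j∸i]≈1 (proj₁ generator) (ℕₚ.<⇒≤ b<a) (≈-sym θ^a≈θ^b)))

      θ^⊕ : ∀ (x y : Fin n) → θ ^ toℕ (x ⊕ y) ≈ θ ^ toℕ x · θ ^ toℕ y
      θ^⊕ x y = begin
        θ ^ toℕ (x ⊕ y)                 ≡⟨ cong (θ ^_) (toℕ-⊕ x y) ⟩
        θ ^ ((toℕ x ℕ.+ toℕ y) % n)     ≈⟨ ≈-sym (x^d≈1⇒x^a≈x^[a%d] n θ^n≈1 _) ⟩
        θ ^ (toℕ x ℕ.+ toℕ y)           ≈⟨ ^-homo-* θ (toℕ x) (toℕ y) ⟩
        θ ^ toℕ x · θ ^ toℕ y           ∎

      θ^modN : ∀ a → θ ^ modN n a ≈ θ ^ a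
      θ^modN a = ≈-trans (reflexive (cong (θ ^_) (modN≡% n a))) (≈-sym (x^d≈1⇒x^a≈x^[a%d] n θ^n≈1 a))

  module QuadraticExtension {q} (2≤q : 2 ≤ q) (card : HasCard (q * q))
      {s} {S : Carrier → Set s} (isSubfield : IsSubfield S) (Scard : SubsetCard S q)
      {θ} (generator : IsGenerator θ) where

    n : ℕ
    n = q * q ∸ 1

    instance
      q≢0 : NonZero q
      q≢0 = >-nonZero (ℕₚ.<-≤-trans (s≤s z≤n) 2≤q)

      q+1≢0 : NonZero (q ℕ.+ 1)
      q+1≢0 = >-nonZero (ℕₚ.m≤n+m 1 q)

    q*q≡1+n : q * q ≡ suc n
    q*q≡1+n = ≡.sym (ℕₚ.suc-pred (q * q) {{ℕₚ.m*n≢0 q q}})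

    open Subfield isSubfield
    open Finite (subst HasCard q*q≡1+n card)
    open Generator generator

    private
      enumS : Fin q → Carrier
      enumS = proj₁ Scard

      enumS-injective : ∀ i j → enumS i ≈ enumS j → i ≡ j
      enumS-injective = proj₁ (proj₂ Scard)

      enumS-∈ : ∀ i → S (enumS i)
      enumS-∈ = proj₁ (proj₂ (proj₂ Scard))

      indexS : ∀ x → S x → Fin q
      indexS x Sx = proj₁ (proj₂ (proj₂ (proj₂ Scard)) x Sx)

      enumS-indexS : ∀ x Sx → enumS (indexS x Sx) ≈ x
      enumS-indexS x Sx = proj₂ (proj₂ (proj₂ (proj₂ Scard)) x Sx)

    indexS-injective : ∀ {x y Sx Sy} → indexS x Sx ≡ indexS y Sy → x ≈ y
    indexS-injective {x} {y} {Sx} {Sy} eq =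
      ≈-trans (≈-sym (enumS-indexS x Sx)) (≈-trans (reflexive (cong enumS eq)) (enumS-indexS y Sy))

    S? : ∀ x → Dec (S x)
    S? x = map′ (λ (i , enumSi≈x) → S-resp enumSi≈x (enumS-∈ i))
                (λ Sx → indexS x Sx , enumS-indexS x Sx)
                (Finₚ.any? (λ i → enumS i ≈? x))

    S-θ^n : S (θ ^ n)
    S-θ^n = S-resp (≈-sym θ^n≈1) S-1

    -- Opaque, like g∣n below: letting Agda unfold the search makes type checking blow up.
    opaque
      period : ∃ (IsLeastPositive (λ k → S (θ ^ k)))
      period = least-positive (λ k → S? (θ ^ k)) (ℕ.>-nonZero⁻¹ n) S-θ^n

    g : ℕ
    g = proj₁ period

    open IsLeastPositive (proj₂ period)

    instance
      g≢0 : NonZero g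
      g≢0 = >-nonZero positive

    S-θ^[m*g] : ∀ m → S (θ ^ (m * g))
    S-θ^[m*g] m = S-resp (≈-trans (^-assocʳ θ g m) (reflexive (cong (θ ^_) (ℕₚ.*-comm g m))))
                         (S-^ m holds)

    -- The remainder θ^(a % g) = θ^a / θ^((a / g) g) lies in F_q, so minimality of g forces it to be 0.
    S-θ^⇒g∣ : ∀ {a} → S (θ ^ a) → g ∣ a
    S-θ^⇒g∣ {a} Sθ^a with a % g ℕ.≟ 0
    ... | yes a%g≡0 = m%n≡0⇒n∣m a g a%g≡0
    ... | no  a%g≢0 = ⊥-elim (minimal (ℕₚ.n≢0⇒n>0 a%g≢0) (m%n<n a g)
                        (S-·-cancelʳ (S-θ^[m*g] (a / g)) (θ^≉0 ((a / g) * g)) (S-resp split Sθ^a)))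
      where
      split : θ ^ a ≈ θ ^ (a % g) · θ ^ ((a / g) * g)
      split = ≈-trans (reflexive (cong (θ ^_) (m≡m%n+[m/n]*n a g))) (^-homo-* θ (a % g) ((a / g) * g))

    opaque
      g∣n : g ∣ n
      g∣n = S-θ^⇒g∣ S-θ^n

    M : ℕ
    M = _∣_.quotient g∣n

    n≡M*g : n ≡ M * g
    n≡M*g = _∣_.equality g∣n

    S-nonzero-log : ∀ {x} → S x → ¬ x ≈ 0# → ∃ λ m → m < M × x ≈ θ ^ (m * g)
    S-nonzero-log Sx x≉0 = m , m<M , ≈-trans x≈θ^a (reflexive (cong (θ ^_) a≡m*g))
      where
      log = log-below n θ^n≈1 x≉0
      a = proj₁ log
      x≈θ^a = proj₂ (proj₂ log)
      g∣a = S-θ^⇒g∣ (S-resp x≈θ^a Sx)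
      m = _∣_.quotient g∣a
      a≡m*g : a ≡ m * g
      a≡m*g = _∣_.equality g∣a
      m<M : m < M
      m<M = ℕₚ.*-cancelʳ-< g m M (≡.subst₂ _<_ a≡m*g n≡M*g (proj₁ (proj₂ log)))

    -- F_q = {0} ∪ {θ^(m g) : m < M}, counted by an injection each way.
    1+M≤q : suc M ≤ q
    1+M≤q = Finₚ.injective⇒≤ {f = toS} toS-injective
      where
      toS : Fin (suc M) → Fin q
      toS Fin.zero    = indexS 0# S-0
      toS (Fin.suc m) = indexS _ (S-θ^[m*g] (toℕ m))

      m*g<n : ∀ (m : Fin M) → toℕ m * g < n
      m*g<n m = subst (toℕ m * g <_) (≡.sym n≡M*g) (ℕₚ.*-monoˡ-< g (Finₚ.toℕ<n m))

      toS-injective : ∀ {i j} → toS i ≡ toS j → i ≡ j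
      toS-injective {Fin.zero}  {Fin.zero}  _  = refl
      toS-injective {Fin.zero}  {Fin.suc m} eq = ⊥-elim (θ^≉0 (toℕ m * g) (≈-sym (indexS-injective eq)))
      toS-injective {Fin.suc m} {Fin.zero}  eq = ⊥-elim (θ^≉0 (toℕ m * g) (indexS-injective eq))
      toS-injective {Fin.suc m} {Fin.suc m′} eq = cong Fin.suc (Finₚ.toℕ-injective
        (ℕₚ.*-cancelʳ-≡ (toℕ m) (toℕ m′) g (θ^-injective (m*g<n m) (m*g<n m′) (indexS-injective eq))))

    q≤1+M : q ≤ suc M
    q≤1+M = Finₚ.injective⇒≤ {f = fromS} (λ {i} {j} → fromS′-injective i j _ _)
      where
      log : ∀ i → ¬ enumS i ≈ 0# → ∃ λ m → m < M × enumS i ≈ θ ^ (m * g)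
      log i = S-nonzero-log (enumS-∈ i)

      fromS′ : ∀ i → Dec (enumS i ≈ 0#) → Fin (suc M)
      fromS′ i (yes _)   = Fin.zero
      fromS′ i (no  i≉0) = Fin.suc (fromℕ< (proj₁ (proj₂ (log i i≉0))))

      fromS : Fin q → Fin (suc M)
      fromS i = fromS′ i (enumS i ≈? 0#)

      fromS′-injective : ∀ i j di dj → fromS′ i di ≡ fromS′ j dj → i ≡ j
      fromS′-injective i j (yes i≈0) (yes j≈0) _ = enumS-injective i j (≈-trans i≈0 (≈-sym j≈0))
      fromS′-injective i j (no i≉0)  (no j≉0)  eq = enumS-injective i j (begin
        enumS i                     ≈⟨ proj₂ (proj₂ (log i i≉0)) ⟩
        θ ^ (proj₁ (log i i≉0) * g) ≡⟨ cong (λ m → θ ^ (m * g))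
                                         (Finₚ.fromℕ<-injective _ _ _ _ (Finₚ.suc-injective eq)) ⟩
        θ ^ (proj₁ (log j j≉0) * g) ≈⟨ ≈-sym (proj₂ (proj₂ (log j j≉0))) ⟩
        enumS j                     ∎)

    q≡1+M : q ≡ suc M
    q≡1+M = ℕₚ.≤-antisym q≤1+M 1+M≤q

    n≡[q∸1]*[q+1] : n ≡ (q ∸ 1) * (q ℕ.+ 1)
    n≡[q∸1]*[q+1] = q*q∸1≡[q∸1]*[q+1] q

    g≡q+1 : g ≡ q ℕ.+ 1
    g≡q+1 = ℕₚ.*-cancelˡ-≡ g (q ℕ.+ 1) M {{M≢0}}
              (≡.trans (≡.sym n≡M*g) (≡.trans n≡[q∸1]*[q+1] (cong (λ k → (k ∸ 1) * (q ℕ.+ 1)) q≡1+M)))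
      where
      M≢0 : NonZero M
      M≢0 = >-nonZero (ℕₚ.≤-pred (subst (2 ≤_) q≡1+M 2≤q))

    S-θ^[k*[q+1]] : ∀ k → S (θ ^ (k * (q ℕ.+ 1)))
    S-θ^[k*[q+1]] k = subst (λ g → S (θ ^ (k * g))) g≡q+1 (S-θ^[m*g] k)

    θ∉S : ¬ S θ
    θ∉S Sθ = minimal (s≤s z≤n) (subst (1 <_) (≡.sym g≡q+1) (ℕₚ.+-monoˡ-< 1 (ℕ.>-nonZero⁻¹ q)))
               (S-resp (≈-sym (*-identityʳ θ)) Sθ)

    coset-edge : ∀ {k i} {x : Fin n} (z : Fin n) → toℕ x ≡ modN n (k * (q ℕ.+ 1) ℕ.+ i) →
                 S (θ ^ toℕ (x ⊕ z) - θ) → S (θ ^ (k * (q ℕ.+ 1)) · (θ ^ i · θ ^ toℕ z) - θ)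
    coset-edge {k} {i} {x} z x≡ = S-resp (+-congʳ (begin
      θ ^ toℕ (x ⊕ z)                                ≈⟨ θ^⊕ x z ⟩
      θ ^ toℕ x · θ ^ toℕ z                          ≡⟨ cong (λ a → θ ^ a · θ ^ toℕ z) x≡ ⟩
      θ ^ modN n (k * (q ℕ.+ 1) ℕ.+ i) · θ ^ toℕ z   ≈⟨ *-congʳ (θ^modN _) ⟩
      θ ^ (k * (q ℕ.+ 1) ℕ.+ i) · θ ^ toℕ z          ≈⟨ *-congʳ (^-homo-* θ (k * (q ℕ.+ 1)) i) ⟩
      (θ ^ (k * (q ℕ.+ 1)) · θ ^ i) · θ ^ toℕ z      ≈⟨ *-assoc _ _ _ ⟩
      θ ^ (k * (q ℕ.+ 1)) · (θ ^ i · θ ^ toℕ z)      ∎))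

    θ^[k*[q+1]]≉1 : ∀ {k} → 0 < k → k ≤ q ∸ 2 → ¬ θ ^ (k * (q ℕ.+ 1)) ≈ 1#
    θ^[k*[q+1]]≉1 {k} 0<k k≤q∸2 = θ^j≉1 (ℕₚ.*-monoˡ-< (q ℕ.+ 1) 0<k)
      (subst (k * (q ℕ.+ 1) <_) (≡.sym n≡[q∸1]*[q+1])
        (ℕₚ.*-monoˡ-< (q ℕ.+ 1) (ℕₚ.≤-<-trans k≤q∸2 (ℕₚ.∸-monoʳ-< (s≤s (s≤s z≤n)) 2≤q))))

    no-common-neighbour : ∀ {k₁ k₂} t → k₂ < k₁ → k₁ ≤ q ∸ 2 →
      S (θ ^ (k₁ * (q ℕ.+ 1)) · t - θ) → ¬ S (θ ^ (k₂ * (q ℕ.+ 1)) · t - θ)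
    no-common-neighbour {k₁} {k₂} t k₂<k₁ k₁≤q∸2 S₁ =
      ab-t∈S⇒b-t∉S θ∉S (S-θ^[k*[q+1]] δ)
        (θ^[k*[q+1]]≉1 (ℕₚ.m<n⇒0<n∸m k₂<k₁) (ℕₚ.≤-trans (ℕₚ.m∸n≤m k₁ k₂) k₁≤q∸2))
        (S-resp (+-congʳ split) S₁)
      where
      δ = k₁ ∸ k₂
      exponents : δ * (q ℕ.+ 1) ℕ.+ k₂ * (q ℕ.+ 1) ≡ k₁ * (q ℕ.+ 1)
      exponents = ≡.trans (cong (ℕ._+ k₂ * (q ℕ.+ 1)) (ℕₚ.*-distribʳ-∸ (q ℕ.+ 1) k₁ k₂))
                    (ℕₚ.m∸n+n≡m (ℕₚ.*-monoˡ-≤ (q ℕ.+ 1) (ℕₚ.<⇒≤ k₂<k₁)))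
      split : θ ^ (k₁ * (q ℕ.+ 1)) · t ≈ θ ^ (δ * (q ℕ.+ 1)) · (θ ^ (k₂ * (q ℕ.+ 1)) · t)
      split = begin
        θ ^ (k₁ * (q ℕ.+ 1)) · t                             ≡⟨ cong (λ a → θ ^ a · t) (≡.sym exponents) ⟩
        θ ^ (δ * (q ℕ.+ 1) ℕ.+ k₂ * (q ℕ.+ 1)) · t           ≈⟨ *-congʳ (^-homo-* θ (δ * (q ℕ.+ 1)) _) ⟩
        (θ ^ (δ * (q ℕ.+ 1)) · θ ^ (k₂ * (q ℕ.+ 1))) · t     ≈⟨ *-assoc _ _ t ⟩
        θ ^ (δ * (q ℕ.+ 1)) · (θ ^ (k₂ * (q ℕ.+ 1)) · t)     ∎

    coset-no-common-neighbour : ∀ {i k₁ k₂} {x y : Fin n} → x ≢ y → k₁ ≤ q ∸ 2 → k₂ ≤ q ∸ 2 →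
      toℕ x ≡ modN n (k₁ * (q ℕ.+ 1) ℕ.+ i) → toℕ y ≡ modN n (k₂ * (q ℕ.+ 1) ℕ.+ i) →
      (z : Fin n) → S (θ ^ toℕ (x ⊕ z) - θ) → ¬ S (θ ^ toℕ (y ⊕ z) - θ)
    coset-no-common-neighbour {i} {k₁} {k₂} x≢y k₁≤ k₂≤ x≡ y≡ z xz yz with ℕₚ.<-cmp k₁ k₂
    ... | tri< k₁<k₂ _ _ =
      no-common-neighbour _ k₁<k₂ k₂≤ (coset-edge {k₂} {i} z y≡ yz) (coset-edge {k₁} {i} z x≡ xz)
    ... | tri≈ _ refl _  = x≢y (Finₚ.toℕ-injective (≡.trans x≡ (≡.sym y≡)))
    ... | tri> _ _ k₂<k₁ =
      no-common-neighbour _ k₂<k₁ k₁≤ (coset-edge {k₁} {i} z x≡ xz) (coset-edge {k₂} {i} z y≡ yz)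

lemma5p3 : ∀ {c ℓ s} (R : CommutativeRing c ℓ) (q : ℕ) → IsPrimePower q
    → FieldDefs.IsField R → FieldDefs.HasCard R (q * q)
    → (S : CommutativeRing.Carrier R → Set s) → FieldDefs.IsSubfield R S → FieldDefs.SubsetCard R S q
    → (θ : CommutativeRing.Carrier R) → FieldDefs.IsGenerator R θ
    → (i : ℕ) → i ≤ q
    → (x y : Fin (q * q ∸ 1)) → x ≢ y
    → FieldDefs.Graph.InCoset R S θ q x i → FieldDefs.Graph.InCoset R S θ q y i
    → ¬ FieldDefs.Graph.PathTwo R S θ q x y
lemma5p3 R q q-primePower isField card S isSubfield Scard θ generator i _ x y x≢y
  (k₁ , k₁≤ , x≡) (k₂ , k₂≤ , y≡) (z , (_ , xz∈A) , (_ , zy∈A)) =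
  coset-no-common-neighbour x≢y k₁≤ k₂≤ x≡ y≡ z xz∈A
    (subst (FieldDefs.Graph.InA R S θ q) (⊕-comm z y) zy∈A)
  where
  open FieldProperties R isField
  open QuadraticExtension (2≤primePower q-primePower) card isSubfield Scard generator
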